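{- Let $1\leq i\leq n$, and let $X_i$ be an $n$-element set of integers such that $\{1,2,\dots,i\}\subseteq X_i\subseteq\{1,2,\dots,i,\pm(i+1),\dots,\pm n\}$ and, for each $r\in\{i+1,\dots,n\}$, exactly one of $r$ and $-r$ belongs to $X_i$. Let $\mathfrak{R}_{n,X_i}$ be the set of permutations $\pi_1\cdots\pi_n$ of $X_i$ with $\pi_n=i$. Then \[ \sum_{\pi\in\mathfrak{R}_{n,X_i}}t^{\mathrm{des}_B(\pi)}=\mathbf{A}_{n,i}(t). \]
   Context: For a permutation $\pi$ of $[n]$, $\mathrm{des}(\pi)=|\{k\in[n-1]:\pi_k>\pi_{k+1}\}|$; $\mathfrak{S}_{n,j}$ is the set of permutations of $[n]$ ending with $j$, and $\mathbf{A}_{n,j}(t)=\sum_{\pi\in\mathfrak{S}_{n,j}}t^{\mathrm{des}(\pi)}$. For a signed permutation $\sigma=\sigma_1\cdots\sigma_n$ of $[n]$, with $\sigma_0=0$, $\mathrm{des}_B(\sigma)=|\{k\in\{0,\dots,n-1\}:\sigma_k>\sigma_{k+1}\}|$. For a set $Y$ of nonzero integers with distinct absolute values, the reduction $\mathrm{red}$ replaces the entry with the $k$-th smallest absolute value by $k$ or $-k$ according to its sign; for a permutation $\pi$ of $Y$ (a word listing the elements of $Y$), $\mathrm{red}(\pi)$ is obtained by applying this replacement entrywise, and $\mathrm{des}_B(\pi):=\mathrm{des}_B(\mathrm{red}(\pi))$. -}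

module Defs where

open import Data.Nat using (ℕ; zero; suc; _+_; _<ᵇ_; _≤ᵇ_; _≡ᵇ_)
open import Data.Integer as ℤ using (ℤ; +_; -_; ∣_∣)
open import Data.Bool using (Bool; true; false; if_then_else_; _∧_)
open import Data.List using (List; []; _∷_; map; concatMap; length)
open import Relation.Nullary.Decidable using (⌊_⌋)

-- all orderings of a list (for a duplicate-free list: all permutations of its elements)
insertAll : {A : Set} → A → List A → List (List A)
insertAll x [] = (x ∷ []) ∷ []
insertAll x (y ∷ ys) = (x ∷ y ∷ ys) ∷ map (y ∷_) (insertAll x ys)

perms : {A : Set} → List A → List (List A)
perms [] = [] ∷ []
perms (x ∷ xs) = concatMap (insertAll x) (perms xs)

count : {A : Set} → (A → Bool) → List A → ℕ
count p [] = 0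
count p (x ∷ xs) = (if p x then 1 else 0) + count p xs

endsWith : {A : Set} → (A → A → Bool) → A → List A → Bool
endsWith eq j [] = false
endsWith eq j (x ∷ []) = eq x j
endsWith eq j (x ∷ y ∷ ys) = endsWith eq j (y ∷ ys)

oneTo : ℕ → List ℕ
oneTo n = go n []
  where
  go : ℕ → List ℕ → List ℕ
  go zero acc = acc
  go (suc k) acc = go k (suc k ∷ acc)

des : List ℕ → ℕ
des [] = 0
des (x ∷ []) = 0
des (x ∷ y ∷ ys) = (if y <ᵇ x then 1 else 0) + des (y ∷ ys)

-- coefficient of t^d in A_{n,j}(t) = sum over permutations of [n] ending with j of t^des
coeffA : ℕ → ℕ → ℕ → ℕ
coeffA n j d =
  count (λ π → endsWith _≡ᵇ_ j π ∧ (des π ≡ᵇ d)) (perms (oneTo n))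

signed : ℤ → ℕ → ℤ
signed x k = if ⌊ x ℤ.<? + 0 ⌋ then - (+ k) else + k

-- reduction: entry with k-th smallest absolute value becomes ±k
-- (k = number of entries whose absolute value is ≤ that of the entry,
--  valid since absolute values are distinct)
red : List ℤ → List ℤ
red π = map (λ x → signed x (count (λ y → ∣ y ∣ ≤ᵇ ∣ x ∣) π)) π

desBFrom : ℤ → List ℤ → ℕ
desBFrom a [] = 0
desBFrom a (x ∷ xs) = (if ⌊ x ℤ.<? a ⌋ then 1 else 0) + desBFrom x xs

desB₀ : List ℤ → ℕ
desB₀ σ = desBFrom (+ 0) σ

desB : List ℤ → ℕ
desB π = desB₀ (red π)

-- coefficient of t^d in  sum_{π ∈ R_{n,X}} t^{des_B π}, where X is given as a
-- duplicate-free list and R_{n,X} = permutations of X ending with i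
coeffR : List ℤ → ℕ → ℕ → ℕ
coeffR X i d =
  count (λ π → endsWith (λ a b → ⌊ a ℤ.≟ b ⌋) (+ i) π ∧ (desB π ≡ᵇ d)) (perms X)

{-# OPTIONS --safe #-}
-- Since the absolute values of the entries of X are exactly 1, …, n, the reduction is the identity
-- and des_B can be read off the words themselves.  If X has negative entries, let −(t+1) be the one
-- of largest absolute value; it is the minimum of X ∪ {0}.  Replacing it by n, and t+2, …, n by
-- t+1, …, n−1, keeps the relative order of 0 and all other entries and turns the minimum into the
-- maximum.  In a word this trades the descent into −(t+1) for the descent out of n, so des_B is
-- unchanged for words that do not end there, in particular for words ending with i.  The new set has
-- one negative entry fewer; once none is left, the words are the permutations of [n] ending with i,
-- on which des_B is des.
module Submission where

open import Defs
open import Data.Nat using (ℕ; suc; _≤_)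
open import Data.Integer using (ℤ; +_; -_; ∣_∣)
import Data.Integer as ℤ
open import Data.List using (List; length)
open import Data.List.Membership.Propositional using (_∈_; _∉_)
open import Data.List.Relation.Unary.Unique.Propositional using (Unique)
open import Data.Product using (_×_)
open import Data.Sum using (_⊎_)
open import Relation.Binary.PropositionalEquality using (_≡_)

import Data.Nat.Properties as ℕₚ
import Data.Integer.Properties as ℤₚ
open import Algebra.Properties.CommutativeSemigroup ℕₚ.+-commutativeSemigroup
  using (x∙yz≈y∙xz; xy∙z≈xz∙y)
open import Data.Bool using (Bool; true; false; if_then_else_; _∧_)
open import Data.Integer using (-[1+_]; +≤+; +<+; -<+; -<-)
open import Data.List
  using ([]; _∷_; [_]; _++_; _∷ʳ_; map; concat; concatMap; applyUpTo)
open import Data.List.Properties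
  using (map-∘; map-++; map-id-local; length-map; length-applyUpTo; ++-assoc;
         applyUpTo-∷ʳ; concat-++; concatMap-map; concatMap-cong; map-concatMap)
open import Data.List.Membership.Propositional using (find)
open import Data.List.Membership.Propositional.Properties
  using (∈-map⁺; ∈-map⁻; ∈-++⁺ˡ; ∈-++⁺ʳ; ∈-++⁻; ∈-∃++; ∈-concatMap⁻; ∈-applyUpTo⁺; ∈-applyUpTo⁻)
open import Data.List.Membership.DecPropositional ℤ._≟_ using (_∈?_)
import Data.List.Relation.Binary.Permutation.Propositional as ↭
open import Data.List.Relation.Binary.Permutation.Propositional
  using (_↭_; ↭-refl; ↭-sym; ↭-trans; ↭-reflexive; prep; swap; module PermutationReasoning)
open import Data.List.Relation.Binary.Permutation.Propositional.Properties
  using (∈-resp-↭; map⁺; ++⁺ˡ; ++⁺; shift; shifts; ↭-length)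
open import Data.List.Relation.Unary.All as All using (All; []; _∷_)
import Data.List.Relation.Unary.All.Properties as All
open import Data.List.Relation.Unary.AllPairs using ([]; _∷_)
open import Data.List.Relation.Unary.Any using (here; there)
open import Data.Nat using (zero; _+_; _<_; _⊓_; _≤ᵇ_; _≡ᵇ_; pred; z≤n; s≤s; s≤s⁻¹; s<s⁻¹)
open import Data.Product using (_,_; proj₁; proj₂; uncurry)
open import Data.Sum using (inj₁; inj₂)
open import Function using (_∘_)
open import Relation.Binary.Definitions using (DecidableEquality; tri<; tri≈; tri>)
open import Relation.Binary.PropositionalEquality
  using (refl; sym; trans; cong; cong₂; subst; module ≡-Reasoning)
open import Relation.Nullary using (Dec; yes; no; ¬_; contradiction)
open import Relation.Nullary.Decidable using (⌊_⌋; isYes≗does)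
open import Relation.Nullary.Reflects using (ofʸ; ofⁿ)

𝟙 : Bool → ℕ
𝟙 b = if b then 1 else 0

isYes-≡ : {A B : Set} {a? : Dec A} {b? : Dec B} → (A → B) → (B → A) → ⌊ a? ⌋ ≡ ⌊ b? ⌋
isYes-≡ {a? = yes a} {yes b} _ _ = refl
isYes-≡ {a? = yes a} {no ¬b} f _ = contradiction (f a) ¬b
isYes-≡ {a? = no ¬a} {yes b} _ g = contradiction (g b) ¬a
isYes-≡ {a? = no ¬a} {no ¬b} _ _ = refl

isYes-true : {A : Set} (a? : Dec A) → A → ⌊ a? ⌋ ≡ true
isYes-true (yes _) _ = refl
isYes-true (no ¬a) a = contradiction a ¬a

isYes-false : {A : Set} (a? : Dec A) → ¬ A → ⌊ a? ⌋ ≡ false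
isYes-false (yes a) ¬a = contradiction a ¬a
isYes-false (no _) _ = refl

∧-cong-true : ∀ b {c c′} → (b ≡ true → c ≡ c′) → b ∧ c ≡ b ∧ c′
∧-cong-true true c≡c′ = c≡c′ refl
∧-cong-true false _ = refl

-- Counting and permutations

module _ {A : Set} (p : A → Bool) where

  count-++ : ∀ xs ys → count p (xs ++ ys) ≡ count p xs + count p ys
  count-++ [] ys = refl
  count-++ (x ∷ xs) ys =
    trans (cong (_+_ (𝟙 (p x))) (count-++ xs ys)) (sym (ℕₚ.+-assoc (𝟙 (p x)) _ _))

  count-↭ : ∀ {xs ys} → xs ↭ ys → count p xs ≡ count p ys
  count-↭ ↭.refl = refl
  count-↭ (↭.prep x xs↭ys) = cong (_+_ (𝟙 (p x))) (count-↭ xs↭ys)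
  count-↭ (↭.swap x y xs↭ys) =
    trans (x∙yz≈y∙xz (𝟙 (p x)) (𝟙 (p y)) _) (cong (λ c → 𝟙 (p y) + (𝟙 (p x) + c)) (count-↭ xs↭ys))
  count-↭ (↭.trans xs↭ys ys↭zs) = trans (count-↭ xs↭ys) (count-↭ ys↭zs)

  count-cong-∈ : ∀ {q} xs → (∀ {x} → x ∈ xs → p x ≡ q x) → count p xs ≡ count q xs
  count-cong-∈ [] _ = refl
  count-cong-∈ (x ∷ xs) p≗q = cong₂ (λ b c → 𝟙 b + c) (p≗q (here refl)) (count-cong-∈ xs (p≗q ∘ there))

count-map : {A B : Set} (p : B → Bool) (f : A → B) (xs : List A) → count p (map f xs) ≡ count (p ∘ f) xs
count-map p f [] = refl
count-map p f (x ∷ xs) = cong (_+_ (𝟙 (p (f x)))) (count-map p f xs)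

module _ {A B : Set} (f : A → B) where

  insertAll-map : ∀ x ys → insertAll (f x) (map f ys) ≡ map (map f) (insertAll x ys)
  insertAll-map x [] = refl
  insertAll-map x (y ∷ ys) = cong ((f x ∷ f y ∷ map f ys) ∷_) (begin
      map (f y ∷_) (insertAll (f x) (map f ys))    ≡⟨ cong (map (f y ∷_)) (insertAll-map x ys) ⟩
      map (f y ∷_) (map (map f) (insertAll x ys))  ≡⟨ map-∘ (insertAll x ys) ⟨
      map (λ w → f y ∷ map f w) (insertAll x ys)   ≡⟨ map-∘ (insertAll x ys) ⟩
      map (map f) (map (y ∷_) (insertAll x ys))    ∎)
    where open ≡-Reasoning

  perms-map : ∀ xs → perms (map f xs) ≡ map (map f) (perms xs)
  perms-map [] = refl
  perms-map (x ∷ xs) = begin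
      concatMap (insertAll (f x)) (perms (map f xs))
        ≡⟨ cong (concatMap (insertAll (f x))) (perms-map xs) ⟩
      concatMap (insertAll (f x)) (map (map f) (perms xs))
        ≡⟨ concatMap-map (insertAll (f x)) (map f) (perms xs) ⟩
      concatMap (insertAll (f x) ∘ map f) (perms xs)
        ≡⟨ concatMap-cong (insertAll-map x) (perms xs) ⟩
      concatMap (map (map f) ∘ insertAll x) (perms xs)
        ≡⟨ map-concatMap (map f) (insertAll x) (perms xs) ⟨
      map (map f) (concatMap (insertAll x) (perms xs)) ∎
    where open ≡-Reasoning

module _ {A B : Set} (f : A → List B) where

  concatMap-++ : ∀ xs ys → concatMap f (xs ++ ys) ≡ concatMap f xs ++ concatMap f ys
  concatMap-++ xs ys = trans (cong concat (map-++ f xs ys)) (sym (concat-++ (map f xs) (map f ys)))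

  concatMap-↭ : ∀ {xs ys} → xs ↭ ys → concatMap f xs ↭ concatMap f ys
  concatMap-↭ ↭.refl = ↭-refl
  concatMap-↭ (↭.prep x xs↭ys) = ++⁺ˡ (f x) (concatMap-↭ xs↭ys)
  concatMap-↭ (↭.swap x y xs↭ys) =
    ↭-trans (shifts (f x) (f y)) (++⁺ˡ (f y) (++⁺ˡ (f x) (concatMap-↭ xs↭ys)))
  concatMap-↭ (↭.trans xs↭ys ys↭zs) = ↭-trans (concatMap-↭ xs↭ys) (concatMap-↭ ys↭zs)

module _ {A : Set} where

  concatMap-insertAll-∷ : ∀ (x z : A) ws →
    concatMap (insertAll x) (map (z ∷_) ws)
      ↭ map (x ∷_) (map (z ∷_) ws) ++ map (z ∷_) (concatMap (insertAll x) ws)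
  concatMap-insertAll-∷ x z [] = ↭-refl
  concatMap-insertAll-∷ x z (w ∷ ws) = prep (x ∷ z ∷ w) (begin
      Z ++ concatMap (insertAll x) (map (z ∷_) ws)       ↭⟨ ++⁺ˡ Z (concatMap-insertAll-∷ x z ws) ⟩
      Z ++ X ++ map (z ∷_) (concatMap (insertAll x) ws)  ↭⟨ shifts Z X ⟩
      X ++ Z ++ map (z ∷_) (concatMap (insertAll x) ws)  ≡⟨ cong (X ++_) (map-++ (z ∷_) (insertAll x w) _) ⟨
      X ++ map (z ∷_) (concatMap (insertAll x) (w ∷ ws)) ∎)
    where
    open PermutationReasoning
    X = map (x ∷_) (map (z ∷_) ws)
    Z = map (z ∷_) (insertAll x w)

  insertAll-comm : ∀ (x y : A) w →
    concatMap (insertAll x) (insertAll y w) ↭ concatMap (insertAll y) (insertAll x w)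
  insertAll-comm x y [] = swap _ _ ↭-refl
  insertAll-comm x y (z ∷ zs) = begin
      xy ∷ yx ∷ P ++ concatMap (insertAll x) (map (z ∷_) (insertAll y zs))
        ↭⟨ prep xy (prep yx (++⁺ˡ P (concatMap-insertAll-∷ x z (insertAll y zs)))) ⟩
      xy ∷ yx ∷ P ++ Q ++ map (z ∷_) (concatMap (insertAll x) (insertAll y zs))
        ↭⟨ swap xy yx (shifts P Q) ⟩
      yx ∷ xy ∷ Q ++ P ++ map (z ∷_) (concatMap (insertAll x) (insertAll y zs))
        ↭⟨ prep yx (prep xy (++⁺ˡ Q (++⁺ˡ P (map⁺ (z ∷_) (insertAll-comm x y zs))))) ⟩
      yx ∷ xy ∷ Q ++ P ++ map (z ∷_) (concatMap (insertAll y) (insertAll x zs))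
        ↭⟨ prep yx (prep xy (++⁺ˡ Q (↭-sym (concatMap-insertAll-∷ y z (insertAll x zs))))) ⟩
      yx ∷ xy ∷ Q ++ concatMap (insertAll y) (map (z ∷_) (insertAll x zs)) ∎
    where
    open PermutationReasoning
    xy = x ∷ y ∷ z ∷ zs
    yx = y ∷ x ∷ z ∷ zs
    P = map (y ∷_) (map (z ∷_) (insertAll x zs))
    Q = map (x ∷_) (map (z ∷_) (insertAll y zs))

  concatMap-insertAll-comm : ∀ (x y : A) ws →
    concatMap (insertAll x) (concatMap (insertAll y) ws)
      ↭ concatMap (insertAll y) (concatMap (insertAll x) ws)
  concatMap-insertAll-comm x y [] = ↭-refl
  concatMap-insertAll-comm x y (w ∷ ws) = begin
      concatMap (insertAll x) (insertAll y w ++ concatMap (insertAll y) ws)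
        ≡⟨ concatMap-++ (insertAll x) (insertAll y w) _ ⟩
      concatMap (insertAll x) (insertAll y w) ++ concatMap (insertAll x) (concatMap (insertAll y) ws)
        ↭⟨ ++⁺ (insertAll-comm x y w) (concatMap-insertAll-comm x y ws) ⟩
      concatMap (insertAll y) (insertAll x w) ++ concatMap (insertAll y) (concatMap (insertAll x) ws)
        ≡⟨ concatMap-++ (insertAll y) (insertAll x w) _ ⟨
      concatMap (insertAll y) (insertAll x w ++ concatMap (insertAll x) ws) ∎
    where open PermutationReasoning

  perms-↭ : {xs ys : List A} → xs ↭ ys → perms xs ↭ perms ys
  perms-↭ ↭.refl = ↭-refl
  perms-↭ (↭.prep x xs↭ys) = concatMap-↭ (insertAll x) (perms-↭ xs↭ys)
  perms-↭ (↭.swap {xs} x y xs↭ys) = ↭-trans (concatMap-insertAll-comm x y (perms xs))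
    (concatMap-↭ (insertAll y) (concatMap-↭ (insertAll x) (perms-↭ xs↭ys)))
  perms-↭ (↭.trans xs↭ys ys↭zs) = ↭-trans (perms-↭ xs↭ys) (perms-↭ ys↭zs)

  ∈-insertAll⇒↭ : ∀ (x : A) w {π} → π ∈ insertAll x w → π ↭ x ∷ w
  ∈-insertAll⇒↭ x [] (here refl) = ↭-refl
  ∈-insertAll⇒↭ x (y ∷ ys) (here refl) = ↭-refl
  ∈-insertAll⇒↭ x (y ∷ ys) (there π∈) with π′ , π′∈ , refl ← ∈-map⁻ (y ∷_) π∈ =
    ↭-trans (prep y (∈-insertAll⇒↭ x ys π′∈)) (swap y x ↭-refl)

  ∈-perms⇒↭ : ∀ xs {π : List A} → π ∈ perms xs → π ↭ xs
  ∈-perms⇒↭ [] (here refl) = ↭-refl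
  ∈-perms⇒↭ (x ∷ xs) π∈ with w , w∈ , π∈insertAll ← find (∈-concatMap⁻ (insertAll x) π∈) =
    ↭-trans (∈-insertAll⇒↭ x w π∈insertAll) (prep x (∈-perms⇒↭ xs w∈))

count-perms-map : {A B : Set} (p : List B → Bool) (q : List A → Bool) (f : A → B) {xs : List A} →
  (∀ {π} → π ∈ perms xs → p (map f π) ≡ q π) → count p (perms (map f xs)) ≡ count q (perms xs)
count-perms-map p q f {xs} p∘f≗q = begin
    count p (perms (map f xs))        ≡⟨ cong (count p) (perms-map f xs) ⟩
    count p (map (map f) (perms xs))  ≡⟨ count-map p (map f) (perms xs) ⟩
    count (p ∘ map f) (perms xs)      ≡⟨ count-cong-∈ (p ∘ map f) (perms xs) p∘f≗q ⟩
    count q (perms xs)                ∎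
  where open ≡-Reasoning

Unique-map⁺-∈ : {A B : Set} {f : A → B} {xs : List A} →
  (∀ {x y} → x ∈ xs → y ∈ xs → f x ≡ f y → x ≡ y) → Unique xs → Unique (map f xs)
Unique-map⁺-∈ {xs = []} _ [] = []
Unique-map⁺-∈ {xs = x ∷ xs} f-inj (x∉ ∷ xs!) =
  All.map⁺ (All.tabulate λ y∈ fx≡fy → All.lookup x∉ y∈ (f-inj (here refl) (there y∈) fx≡fy))
  ∷ Unique-map⁺-∈ (λ x∈ y∈ → f-inj (there x∈) (there y∈)) xs!

unique∧⊆∧length⇒↭ : {A : Set} {xs ys : List A} →
  Unique xs → (∀ {x} → x ∈ xs → x ∈ ys) → length ys ≤ length xs → xs ↭ ys
unique∧⊆∧length⇒↭ {xs = []} {[]} _ _ _ = ↭-refl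
unique∧⊆∧length⇒↭ {xs = x ∷ xs} (x∉xs ∷ xs!) xs⊆ys ys≤xs
  with us , vs , refl ← ∈-∃++ (xs⊆ys (here refl)) =
  ↭-trans (prep x (unique∧⊆∧length⇒↭ xs! xs⊆us++vs us++vs≤xs)) (↭-sym (shift x us vs))
  where
  xs⊆us++vs : ∀ {z} → z ∈ xs → z ∈ us ++ vs
  xs⊆us++vs z∈xs with ∈-++⁻ us (xs⊆ys (there z∈xs))
  ... | inj₁ z∈us = ∈-++⁺ˡ z∈us
  ... | inj₂ (here refl) = contradiction refl (All.lookup x∉xs z∈xs)
  ... | inj₂ (there z∈vs) = ∈-++⁺ʳ us z∈vs
  us++vs≤xs : length (us ++ vs) ≤ length xs
  us++vs≤xs = s≤s⁻¹ (subst (_≤ suc (length xs)) (↭-length (shift x us vs)) ys≤xs)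

-- The accumulator loop of oneTo is local to its where block; unification names it here.
mutual
  oneTo-loop : ℕ → ℕ → List ℕ → List ℕ
  oneTo-loop = _

  oneTo-suc : ∀ n → oneTo (suc n) ≡ oneTo-loop (suc n) n [ suc n ]
  oneTo-suc n with [ suc n ]
  ... | _ with suc n
  ... | _ = refl

oneTo-loop≡ : ∀ m k acc → oneTo-loop m k acc ≡ applyUpTo suc k ++ acc
oneTo-loop≡ m zero acc = refl
oneTo-loop≡ m (suc k) acc = begin
    oneTo-loop m k (suc k ∷ acc)       ≡⟨ oneTo-loop≡ m k (suc k ∷ acc) ⟩
    applyUpTo suc k ++ suc k ∷ acc     ≡⟨ ++-assoc (applyUpTo suc k) [ suc k ] acc ⟨
    (applyUpTo suc k ∷ʳ suc k) ++ acc  ≡⟨ cong (_++ acc) (applyUpTo-∷ʳ suc k) ⟩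
    applyUpTo suc (suc k) ++ acc       ∎
  where open ≡-Reasoning

oneTo≡applyUpTo : ∀ n → oneTo n ≡ applyUpTo suc n
oneTo≡applyUpTo zero = refl
oneTo≡applyUpTo (suc n) =
  trans (oneTo-suc n) (trans (oneTo-loop≡ (suc n) n [ suc n ]) (applyUpTo-∷ʳ suc n))

length-oneTo : ∀ n → length (oneTo n) ≡ n
length-oneTo n = trans (cong length (oneTo≡applyUpTo n)) (length-applyUpTo suc n)

∈-oneTo⁺ : ∀ {n k} → 1 ≤ k → k ≤ n → k ∈ oneTo n
∈-oneTo⁺ {n} (s≤s z≤n) k≤n = subst (_ ∈_) (sym (oneTo≡applyUpTo n)) (∈-applyUpTo⁺ suc k≤n)

∈-oneTo⁻ : ∀ {n k} → k ∈ oneTo n → k ≤ n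
∈-oneTo⁻ {n} k∈ with j , j<n , refl ← ∈-applyUpTo⁻ suc (subst (_ ∈_) (oneTo≡applyUpTo n) k∈) = j<n

⊓-suc : ∀ n m → n ⊓ m + 𝟙 (suc n ≤ᵇ m) ≡ suc n ⊓ m
⊓-suc n m with suc n ≤ᵇ m | ℕₚ.≤ᵇ-reflects-≤ (suc n) m
... | true | ofʸ n<m = begin
    n ⊓ m + 1    ≡⟨ cong (_+ 1) (ℕₚ.m≤n⇒m⊓n≡m (ℕₚ.<⇒≤ n<m)) ⟩
    n + 1        ≡⟨ ℕₚ.+-comm n 1 ⟩
    suc n        ≡⟨ ℕₚ.m≤n⇒m⊓n≡m n<m ⟨
    suc n ⊓ m    ∎
  where open ≡-Reasoning
... | false | ofⁿ n≮m = begin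
    n ⊓ m + 0    ≡⟨ ℕₚ.+-identityʳ _ ⟩
    n ⊓ m        ≡⟨ ℕₚ.m≥n⇒m⊓n≡n m≤n ⟩
    m            ≡⟨ ℕₚ.m≥n⇒m⊓n≡n (ℕₚ.m≤n⇒m≤1+n m≤n) ⟨
    suc n ⊓ m    ∎
  where open ≡-Reasoning
        m≤n = ℕₚ.≮⇒≥ n≮m

count-≤ᵇ-applyUpTo : ∀ m n → count (_≤ᵇ m) (applyUpTo suc n) ≡ n ⊓ m
count-≤ᵇ-applyUpTo m zero = refl
count-≤ᵇ-applyUpTo m (suc n) = begin
    count (_≤ᵇ m) (applyUpTo suc (suc n))
      ≡⟨ cong (count (_≤ᵇ m)) (applyUpTo-∷ʳ suc n) ⟨
    count (_≤ᵇ m) (applyUpTo suc n ++ [ suc n ])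
      ≡⟨ count-++ (_≤ᵇ m) (applyUpTo suc n) [ suc n ] ⟩
    count (_≤ᵇ m) (applyUpTo suc n) + (𝟙 (suc n ≤ᵇ m) + 0)
      ≡⟨ cong₂ _+_ (count-≤ᵇ-applyUpTo m n) (ℕₚ.+-identityʳ _) ⟩
    n ⊓ m + 𝟙 (suc n ≤ᵇ m)
      ≡⟨ ⊓-suc n m ⟩
    suc n ⊓ m ∎
  where open ≡-Reasoning

count-≤ᵇ-oneTo : ∀ m n → count (_≤ᵇ m) (oneTo n) ≡ n ⊓ m
count-≤ᵇ-oneTo m n = trans (cong (count (_≤ᵇ m)) (oneTo≡applyUpTo n)) (count-≤ᵇ-applyUpTo m n)

lastOf : {A : Set} → A → List A → A
lastOf a [] = a
lastOf a (x ∷ xs) = lastOf x xs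

endsWith-lastOf : {A : Set} (_≟_ : DecidableEquality A) {j : A} (a : A) (w : List A) →
  endsWith (λ x y → ⌊ x ≟ y ⌋) j w ≡ true → lastOf a w ≡ j
endsWith-lastOf _≟_ {j} a (x ∷ []) ends with x ≟ j
... | yes x≡j = x≡j
endsWith-lastOf _≟_ a (x ∷ y ∷ w) ends = endsWith-lastOf _≟_ x (y ∷ w) ends

endsWith-map : {A B : Set} {_==_ : A → A → Bool} {_==′_ : B → B → Bool} {j : A} {j′ : B}
  (f : A → B) (w : List A) → (∀ {x} → x ∈ w → (f x ==′ j′) ≡ (x == j)) →
  endsWith _==′_ j′ (map f w) ≡ endsWith _==_ j w
endsWith-map f [] _ = refl
endsWith-map f (x ∷ []) f≗ = f≗ (here refl)
endsWith-map f (x ∷ y ∷ w) f≗ = endsWith-map f (y ∷ w) (f≗ ∘ there)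

desBFrom-map+ : ∀ a w → desBFrom (+ a) (map +_ w) ≡ des (a ∷ w)
desBFrom-map+ a [] = refl
desBFrom-map+ a (b ∷ w) =
  cong₂ (λ c d → 𝟙 c + d) (isYes≗does (+ b ℤ.<? + a)) (desBFrom-map+ b w)

desB₀-map+ : ∀ w → desB₀ (map +_ w) ≡ des w
desB₀-map+ [] = refl
desB₀-map+ (a ∷ w) = desBFrom-map+ a w

-- Maps sending the minimum to the maximum

record MinToMax (φ : ℤ → ℤ) (m : ℤ) (R : ℤ → Set) : Set where
  field
    monotone : ∀ {x y} → R x → R y → x ℤ.< y → φ x ℤ.< φ y
    min<     : ∀ {x} → R x → m ℤ.< x
    <max     : ∀ {x} → R x → φ x ℤ.< φ m

  reflects : ∀ {x y} → R x → R y → φ x ℤ.< φ y → x ℤ.< y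
  reflects {x} {y} rx ry φx<φy with ℤₚ.<-cmp x y
  ... | tri< x<y _ _ = x<y
  ... | tri≈ _ refl _ = contradiction φx<φy (ℤₚ.<-irrefl refl)
  ... | tri> _ _ y<x = contradiction (monotone ry rx y<x) (ℤₚ.<-asym φx<φy)

  injective : ∀ {x y} → x ≡ m ⊎ R x → y ≡ m ⊎ R y → φ x ≡ φ y → x ≡ y
  injective (inj₁ refl) (inj₁ refl) _ = refl
  injective (inj₁ refl) (inj₂ ry) φm≡φy = contradiction (<max ry) (ℤₚ.<-irrefl (sym φm≡φy))
  injective (inj₂ rx) (inj₁ refl) φx≡φm = contradiction (<max rx) (ℤₚ.<-irrefl φx≡φm)
  injective {x} {y} (inj₂ rx) (inj₂ ry) φx≡φy with ℤₚ.<-cmp x y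
  ... | tri< x<y _ _ = contradiction (monotone rx ry x<y) (ℤₚ.<-irrefl φx≡φy)
  ... | tri≈ _ x≡y _ = x≡y
  ... | tri> _ _ y<x = contradiction (monotone ry rx y<x) (ℤₚ.<-irrefl (sym φx≡φy))

  isMin : ℤ → ℕ
  isMin x = 𝟙 ⌊ x ℤ.≟ m ⌋

  isMin-m : isMin m ≡ 1
  isMin-m = cong 𝟙 (isYes-true (m ℤ.≟ m) refl)

  isMin-R : ∀ {x} → R x → isMin x ≡ 0
  isMin-R rx = cong 𝟙 (isYes-false (_ ℤ.≟ m) λ x≡m → ℤₚ.<-irrefl (sym x≡m) (min< rx))

  -- Entering m is a descent and leaving it is not; after φ it is the other way round,
  -- so the descent moves one step to the right.
  descent-map : ∀ {a b} → a ≡ m ⊎ R a → b ≡ m ⊎ R b →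
    𝟙 ⌊ b ℤ.<? a ⌋ + isMin a ≡ 𝟙 ⌊ φ b ℤ.<? φ a ⌋ + isMin b
  descent-map (inj₁ refl) (inj₁ refl)
    rewrite isYes-false (m ℤ.<? m) (ℤₚ.<-irrefl refl)
          | isYes-false (φ m ℤ.<? φ m) (ℤₚ.<-irrefl refl) = refl
  descent-map {b = b} (inj₁ refl) (inj₂ rb)
    rewrite isYes-false (b ℤ.<? m) (ℤₚ.<-asym (min< rb)) | isYes-true (φ b ℤ.<? φ m) (<max rb)
          | isMin-m | isMin-R rb = refl
  descent-map {a = a} (inj₂ ra) (inj₁ refl)
    rewrite isYes-true (m ℤ.<? a) (min< ra) | isYes-false (φ m ℤ.<? φ a) (ℤₚ.<-asym (<max ra))
          | isMin-m | isMin-R ra = refl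
  descent-map (inj₂ ra) (inj₂ rb) rewrite isMin-R ra | isMin-R rb =
    cong (λ c → 𝟙 c + 0) (isYes-≡ (monotone rb ra) (reflects rb ra))

  desBFrom-map : ∀ {a} w → a ≡ m ⊎ R a → All (λ x → x ≡ m ⊎ R x) w →
    desBFrom a w + isMin a ≡ desBFrom (φ a) (map φ w) + isMin (lastOf a w)
  desBFrom-map [] _ [] = refl
  desBFrom-map {a} (b ∷ w) ra (rb ∷ rw) = begin
      (𝟙 ⌊ b ℤ.<? a ⌋ + desBFrom b w) + isMin a          ≡⟨ xy∙z≈xz∙y (𝟙 ⌊ b ℤ.<? a ⌋) _ _ ⟩
      (𝟙 ⌊ b ℤ.<? a ⌋ + isMin a) + desBFrom b w          ≡⟨ cong (_+ desBFrom b w) (descent-map ra rb) ⟩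
      (δ + isMin b) + desBFrom b w                        ≡⟨ xy∙z≈xz∙y δ (isMin b) _ ⟩
      (δ + desBFrom b w) + isMin b                        ≡⟨ ℕₚ.+-assoc δ _ _ ⟩
      δ + (desBFrom b w + isMin b)                        ≡⟨ cong (_+_ δ) (desBFrom-map w rb rw) ⟩
      δ + (desBFrom (φ b) (map φ w) + isMin (lastOf b w)) ≡⟨ ℕₚ.+-assoc δ _ _ ⟨
      (δ + desBFrom (φ b) (map φ w)) + isMin (lastOf b w) ∎
    where open ≡-Reasoning
          δ = 𝟙 ⌊ φ b ℤ.<? φ a ⌋

  desB₀-map : R (+ 0) → φ (+ 0) ≡ + 0 → ∀ {w} → All (λ x → x ≡ m ⊎ R x) w → R (lastOf (+ 0) w) →
    desB₀ (map φ w) ≡ desB₀ w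
  desB₀-map r0 φ0≡0 {w} rw rlast = begin
      desBFrom (+ 0) (map φ w)                   ≡⟨ cong (λ z → desBFrom z (map φ w)) φ0≡0 ⟨
      D′                                         ≡⟨ ℕₚ.+-identityʳ D′ ⟨
      D′ + 0                                     ≡⟨ cong (_+_ D′) (isMin-R rlast) ⟨
      D′ + isMin (lastOf (+ 0) w)                ≡⟨ desBFrom-map w (inj₂ r0) rw ⟨
      desBFrom (+ 0) w + isMin (+ 0)             ≡⟨ cong (_+_ (desBFrom (+ 0) w)) (isMin-R r0) ⟩
      desBFrom (+ 0) w + 0                       ≡⟨ ℕₚ.+-identityʳ _ ⟩
      desB₀ w                                    ∎
    where open ≡-Reasoning
          D′ = desBFrom (φ (+ 0)) (map φ w)

-- Removing the negative entry of largest absolute value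

rotate : ℕ → ℕ → ℤ → ℤ
rotate t n (+ k) with suc t ℕₚ.<? k
... | yes _ = + pred k
... | no _ = + k
rotate t n -[1+ k ] with k ℕₚ.≟ t
... | yes _ = + n
... | no _ = -[1+ k ]

-- The entries other than −(t+1), together with 0, of a signed set containing −(t+1);
-- +(t+1) is not among them.
data Regular (t n : ℕ) : ℤ → Set where
  below : ∀ {k} → k ≤ t → Regular t n (+ k)
  above : ∀ {k} → t < k → k < n → Regular t n (+ suc k)
  neg   : ∀ {k} → k < t → Regular t n -[1+ k ]

module _ {t n : ℕ} where

  rotate-min : rotate t n -[1+ t ] ≡ + n
  rotate-min with t ℕₚ.≟ t
  ... | yes _ = refl
  ... | no t≢t = contradiction refl t≢t

  rotate-below : ∀ {k} → k ≤ t → rotate t n (+ k) ≡ + k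
  rotate-below {k} k≤t with suc t ℕₚ.<? k
  ... | yes t+1<k = contradiction k≤t (ℕₚ.<⇒≱ (ℕₚ.<⇒≤ t+1<k))
  ... | no _ = refl

  rotate-above : ∀ {k} → t < k → rotate t n (+ suc k) ≡ + k
  rotate-above {k} t<k with suc t ℕₚ.<? suc k
  ... | yes _ = refl
  ... | no t+1≮k+1 = contradiction (s≤s t<k) t+1≮k+1

  rotate-neg : ∀ {k} → k < t → rotate t n -[1+ k ] ≡ -[1+ k ]
  rotate-neg {k} k<t with k ℕₚ.≟ t
  ... | yes k≡t = contradiction k≡t (ℕₚ.<⇒≢ k<t)
  ... | no _ = refl

  rotate-monotone : ∀ {x y} → Regular t n x → Regular t n y → x ℤ.< y → rotate t n x ℤ.< rotate t n y
  rotate-monotone (below a≤t) (below b≤t) x<y rewrite rotate-below a≤t | rotate-below b≤t = x<y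
  rotate-monotone (below a≤t) (above t<b _) _ rewrite rotate-below a≤t | rotate-above t<b =
    +<+ (ℕₚ.≤-<-trans a≤t t<b)
  rotate-monotone (above t<a _) (below b≤t) (+<+ a+1<b) =
    contradiction (ℕₚ.<-≤-trans (ℕₚ.<⇒≤ a+1<b) b≤t) (ℕₚ.<-asym t<a)
  rotate-monotone (above t<a _) (above t<b _) (+<+ a+1<b+1)
    rewrite rotate-above t<a | rotate-above t<b = +<+ (s<s⁻¹ a+1<b+1)
  rotate-monotone (neg a<t) (below b≤t) _ rewrite rotate-neg a<t | rotate-below b≤t = -<+
  rotate-monotone (neg a<t) (above t<b _) _ rewrite rotate-neg a<t | rotate-above t<b = -<+
  rotate-monotone (neg a<t) (neg b<t) x<y rewrite rotate-neg a<t | rotate-neg b<t = x<y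

  rotate-minToMax : t < n → MinToMax (rotate t n) -[1+ t ] (Regular t n)
  rotate-minToMax t<n = record { monotone = rotate-monotone ; min< = min< ; <max = <max }
    where
    min< : ∀ {x} → Regular t n x → -[1+ t ] ℤ.< x
    min< (below _) = -<+
    min< (above _ _) = -<+
    min< (neg k<t) = -<- k<t
    <max : ∀ {x} → Regular t n x → rotate t n x ℤ.< rotate t n -[1+ t ]
    <max (below k≤t) rewrite rotate-below k≤t | rotate-min = +<+ (ℕₚ.≤-<-trans k≤t t<n)
    <max (above t<k k<n) rewrite rotate-above t<k | rotate-min = +<+ k<n
    <max (neg k<t) rewrite rotate-neg k<t | rotate-min = -<+

  rotate-negative : ∀ {x k} → x ≡ -[1+ t ] ⊎ Regular t n x →
    rotate t n x ≡ -[1+ k ] → x ≡ -[1+ k ] × k < t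
  rotate-negative (inj₁ refl) φx≡-k = contradiction (trans (sym rotate-min) φx≡-k) λ ()
  rotate-negative (inj₂ (below j≤t)) φx≡-k = contradiction (trans (sym (rotate-below j≤t)) φx≡-k) λ ()
  rotate-negative (inj₂ (above t<j _)) φx≡-k = contradiction (trans (sym (rotate-above t<j)) φx≡-k) λ ()
  rotate-negative (inj₂ (neg j<t)) φx≡-k with refl ← trans (sym (rotate-neg j<t)) φx≡-k = refl , j<t

  rotate-positive : ∀ {x k} → t < n → k < t → x ≡ -[1+ t ] ⊎ Regular t n x →
    rotate t n x ≡ + suc k → x ≡ + suc k
  rotate-positive t<n k<t (inj₁ refl) φx≡k+1 with refl ← trans (sym rotate-min) φx≡k+1 =
    contradiction (s≤s⁻¹ t<n) (ℕₚ.<⇒≱ k<t)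
  rotate-positive t<n k<t (inj₂ (below j≤t)) φx≡k+1 = trans (sym (rotate-below j≤t)) φx≡k+1
  rotate-positive t<n k<t (inj₂ (above t<j _)) φx≡k+1 with refl ← trans (sym (rotate-above t<j)) φx≡k+1 =
    contradiction k<t (ℕₚ.<⇒≱ t<j)
  rotate-positive t<n k<t (inj₂ (neg j<t)) φx≡k+1 =
    contradiction (trans (sym (rotate-neg j<t)) φx≡k+1) λ ()

  rotate-abs-bounds : ∀ {x} → t < n → x ≡ -[1+ t ] ⊎ Regular t n x →
    1 ≤ ∣ x ∣ × ∣ x ∣ ≤ n → 1 ≤ ∣ rotate t n x ∣ × ∣ rotate t n x ∣ ≤ n
  rotate-abs-bounds t<n (inj₁ refl) _ rewrite rotate-min = ℕₚ.≤-trans (s≤s z≤n) t<n , ℕₚ.≤-refl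
  rotate-abs-bounds t<n (inj₂ (below k≤t)) bounds rewrite rotate-below k≤t = bounds
  rotate-abs-bounds t<n (inj₂ (above t<k k<n)) _ rewrite rotate-above t<k =
    ℕₚ.≤-trans (s≤s z≤n) t<k , ℕₚ.<⇒≤ k<n
  rotate-abs-bounds t<n (inj₂ (neg k<t)) bounds rewrite rotate-neg k<t = bounds

-- Signed sets

record SignedSet (n i b : ℕ) (X : List ℤ) : Set where
  field
    length≡n    : length X ≡ n
    unique      : Unique X
    no-opposite : ∀ {k} → + suc k ∈ X → -[1+ k ] ∉ X
    abs-bounds  : ∀ {x} → x ∈ X → 1 ≤ ∣ x ∣ × ∣ x ∣ ≤ n
    neg-bounds  : ∀ {k} → -[1+ k ] ∈ X → i ≤ k × k < i + b

  abs-injective : ∀ {x y} → x ∈ X → y ∈ X → ∣ x ∣ ≡ ∣ y ∣ → x ≡ y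
  abs-injective {+ _} {+ _} _ _ refl = refl
  abs-injective { -[1+ _ ]} { -[1+ _ ]} _ _ refl = refl
  abs-injective {+ _} { -[1+ _ ]} x∈X y∈X refl = contradiction y∈X (no-opposite x∈X)
  abs-injective { -[1+ _ ]} {+ _} x∈X y∈X refl = contradiction x∈X (no-opposite y∈X)

  abs↭oneTo : map ∣_∣ X ↭ oneTo n
  abs↭oneTo = unique∧⊆∧length⇒↭ (Unique-map⁺-∈ abs-injective unique) abs∈oneTo
    (ℕₚ.≤-reflexive (trans (length-oneTo n) (trans (sym length≡n) (sym (length-map ∣_∣ X)))))
    where
    abs∈oneTo : ∀ {k} → k ∈ map ∣_∣ X → k ∈ oneTo n
    abs∈oneTo k∈ with _ , x∈X , refl ← ∈-map⁻ ∣_∣ k∈ = uncurry ∈-oneTo⁺ (abs-bounds x∈X)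

SignedSet-shrink : ∀ {n i b X} → SignedSet n i (suc b) X → -[1+ i + b ] ∉ X → SignedSet n i b X
SignedSet-shrink {i = i} {b} {X} X-signed min∉X = record
  { length≡n = length≡n ; unique = unique ; no-opposite = no-opposite
  ; abs-bounds = abs-bounds ; neg-bounds = neg-bounds′ }
  where
  open SignedSet X-signed
  neg-bounds′ : ∀ {k} → -[1+ k ] ∈ X → i ≤ k × k < i + b
  neg-bounds′ {k} -k∈X with i≤k , k<i+b+1 ← neg-bounds -k∈X =
    i≤k , ℕₚ.≤∧≢⇒< (s≤s⁻¹ (subst (k <_) (ℕₚ.+-suc i b) k<i+b+1)) λ { refl → min∉X -k∈X }

SignedSet⇒↭positive : ∀ {n i X} → SignedSet n i 0 X → X ↭ map +_ (oneTo n)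
SignedSet⇒↭positive {i = i} {X} X-signed = ↭-trans (↭-reflexive X≡+∣X∣) (map⁺ +_ abs↭oneTo)
  where
  open SignedSet X-signed
  nonnegative : ∀ {x} → x ∈ X → + ∣ x ∣ ≡ x
  nonnegative {+ _} _ = refl
  nonnegative { -[1+ k ]} x∈X with i≤k , k<i+0 ← neg-bounds x∈X =
    contradiction i≤k (ℕₚ.<⇒≱ (subst (k <_) (ℕₚ.+-identityʳ i) k<i+0))
  X≡+∣X∣ : X ≡ map +_ (map ∣_∣ X)
  X≡+∣X∣ = trans (sym (map-id-local (All.tabulate nonnegative))) (map-∘ X)

_==_ : ℤ → ℤ → Bool
a == b = ⌊ a ℤ.≟ b ⌋

isCounted : ℕ → ℕ → List ℤ → Bool
isCounted i d π = endsWith _==_ (+ i) π ∧ (desB₀ π ≡ᵇ d)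

coeffR₀ : List ℤ → ℕ → ℕ → ℕ
coeffR₀ X i d = count (isCounted i d) (perms X)

coeffR₀-↭ : ∀ {X Y} i d → X ↭ Y → coeffR₀ X i d ≡ coeffR₀ Y i d
coeffR₀-↭ i d X↭Y = count-↭ (isCounted i d) (perms-↭ X↭Y)

coeffR₀-oneTo : ∀ n i d → coeffR₀ (map +_ (oneTo n)) i d ≡ coeffA n i d
coeffR₀-oneTo n i d =
  count-perms-map (isCounted i d) (λ π → endsWith _≡ᵇ_ i π ∧ (des π ≡ᵇ d)) +_ {oneTo n} λ {π} _ →
    cong₂ _∧_ (endsWith-map +_ π λ {x} _ → isYes≗does (+ x ℤ.≟ + i)) (cong (_≡ᵇ d) (desB₀-map+ π))

module _ {n i b : ℕ} {X : List ℤ} (X-signed : SignedSet n i (suc b) X) (min∈X : -[1+ i + b ] ∈ X) where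
  open SignedSet X-signed

  private
    t = i + b
    φ = rotate t n

    t<n : t < n
    t<n = proj₂ (abs-bounds min∈X)

    classify : ∀ {x} → x ∈ X → x ≡ -[1+ t ] ⊎ Regular t n x
    classify {+ zero} _ = inj₂ (below z≤n)
    classify {+ suc k} x∈X with ℕₚ.<-cmp k t
    ... | tri< k<t _ _ = inj₂ (below k<t)
    ... | tri≈ _ refl _ = contradiction min∈X (no-opposite x∈X)
    ... | tri> _ _ t<k = inj₂ (above t<k (proj₂ (abs-bounds x∈X)))
    classify { -[1+ k ]} x∈X with ℕₚ.<-cmp k t
    ... | tri< k<t _ _ = inj₂ (neg k<t)
    ... | tri≈ _ refl _ = inj₁ refl
    ... | tri> _ _ t<k =
      contradiction (s≤s⁻¹ (subst (k <_) (ℕₚ.+-suc i b) (proj₂ (neg-bounds x∈X)))) (ℕₚ.<⇒≱ t<k)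

    φ-minToMax : MinToMax φ -[1+ t ] (Regular t n)
    φ-minToMax = rotate-minToMax t<n

  open MinToMax φ-minToMax using (injective; desB₀-map)

  rotate-SignedSet : SignedSet n i b (map (rotate (i + b) n) X)
  rotate-SignedSet = record
    { length≡n = trans (length-map φ X) length≡n
    ; unique = Unique-map⁺-∈ (λ x∈ y∈ → injective (classify x∈) (classify y∈)) unique
    ; no-opposite = no-opposite′
    ; abs-bounds = abs-bounds′
    ; neg-bounds = neg-bounds′
    }
    where
    no-opposite′ : ∀ {k} → + suc k ∈ map φ X → -[1+ k ] ∉ map φ X
    no-opposite′ +k∈ -k∈
      with x , x∈X , +k≡φx ← ∈-map⁻ φ +k∈ | y , y∈X , -k≡φy ← ∈-map⁻ φ -k∈
      with refl , k<t ← rotate-negative (classify y∈X) (sym -k≡φy) =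
      no-opposite (subst (_∈ X) (rotate-positive t<n k<t (classify x∈X) (sym +k≡φx)) x∈X) y∈X
    abs-bounds′ : ∀ {x} → x ∈ map φ X → 1 ≤ ∣ x ∣ × ∣ x ∣ ≤ n
    abs-bounds′ x∈ with y , y∈X , refl ← ∈-map⁻ φ x∈ =
      rotate-abs-bounds t<n (classify y∈X) (abs-bounds y∈X)
    neg-bounds′ : ∀ {k} → -[1+ k ] ∈ map φ X → i ≤ k × k < i + b
    neg-bounds′ -k∈ with y , y∈X , -k≡φy ← ∈-map⁻ φ -k∈
      with refl , k<t ← rotate-negative (classify y∈X) (sym -k≡φy) = proj₁ (neg-bounds y∈X) , k<t

  coeffR₀-rotate : ∀ d → coeffR₀ (map (rotate (i + b) n) X) i d ≡ coeffR₀ X i d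
  coeffR₀-rotate d = count-perms-map (isCounted i d) (isCounted i d) φ {X} counted
    where
    i-regular : Regular t n (+ i)
    i-regular = below (ℕₚ.m≤m+n i b)
    φi≡i : φ (+ i) ≡ + i
    φi≡i = rotate-below {t} {n} (ℕₚ.m≤m+n i b)
    counted : ∀ {π} → π ∈ perms X → isCounted i d (map φ π) ≡ isCounted i d π
    counted {π} π∈ = trans (cong (_∧ (desB₀ (map φ π) ≡ᵇ d)) ends)
      (∧-cong-true (endsWith _==_ (+ i) π) λ ends-i →
        cong (_≡ᵇ d) (desB₀-map (below z≤n) (rotate-below {t} {n} z≤n) π-classified
          (subst (Regular t n) (sym (endsWith-lastOf ℤ._≟_ (+ 0) π ends-i)) i-regular)))
      where
      π-classified : All (λ x → x ≡ -[1+ t ] ⊎ Regular t n x) π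
      π-classified = All.tabulate (classify ∘ ∈-resp-↭ (∈-perms⇒↭ X π∈))
      ends : endsWith _==_ (+ i) (map φ π) ≡ endsWith _==_ (+ i) π
      ends = endsWith-map φ π λ x∈π → isYes-≡
        (λ φx≡i → injective (All.lookup π-classified x∈π) (inj₂ i-regular)
          (trans φx≡i (sym φi≡i)))
        (λ x≡i → trans (cong φ x≡i) φi≡i)

coeffR₀≡coeffA : ∀ {n i} b {X} d → SignedSet n i b X → coeffR₀ X i d ≡ coeffA n i d
coeffR₀≡coeffA {n} {i} zero d X-signed =
  trans (coeffR₀-↭ i d (SignedSet⇒↭positive X-signed)) (coeffR₀-oneTo n i d)
coeffR₀≡coeffA {n} {i} (suc b) {X} d X-signed with -[1+ i + b ] ∈? X
... | yes min∈X = trans (sym (coeffR₀-rotate X-signed min∈X d))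
                        (coeffR₀≡coeffA b d (rotate-SignedSet X-signed min∈X))
... | no min∉X = coeffR₀≡coeffA b d (SignedSet-shrink X-signed min∉X)

-- Reduction and the theorem

signed-abs : ∀ x → signed x ∣ x ∣ ≡ x
signed-abs (+ _) = refl
signed-abs -[1+ _ ] = refl

red-id : ∀ {n} π → map ∣_∣ π ↭ oneTo n → red π ≡ π
red-id {n} π ∣π∣↭oneTo = map-id-local (All.tabulate λ {x} x∈π → begin
    signed x (count (λ y → ∣ y ∣ ≤ᵇ ∣ x ∣) π)  ≡⟨ cong (signed x) (rank x∈π) ⟩
    signed x ∣ x ∣                           ≡⟨ signed-abs x ⟩
    x                                        ∎)
  where
  open ≡-Reasoning
  rank : ∀ {x} → x ∈ π → count (λ y → ∣ y ∣ ≤ᵇ ∣ x ∣) π ≡ ∣ x ∣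
  rank {x} x∈π = begin
    count (λ y → ∣ y ∣ ≤ᵇ ∣ x ∣) π    ≡⟨ count-map (_≤ᵇ ∣ x ∣) ∣_∣ π ⟨
    count (_≤ᵇ ∣ x ∣) (map ∣_∣ π)     ≡⟨ count-↭ (_≤ᵇ ∣ x ∣) ∣π∣↭oneTo ⟩
    count (_≤ᵇ ∣ x ∣) (oneTo n)       ≡⟨ count-≤ᵇ-oneTo ∣ x ∣ n ⟩
    n ⊓ ∣ x ∣                         ≡⟨ ℕₚ.m≥n⇒m⊓n≡n (∈-oneTo⁻ (∈-resp-↭ ∣π∣↭oneTo (∈-map⁺ ∣_∣ x∈π))) ⟩
    ∣ x ∣                             ∎

coeffR≡coeffR₀ : ∀ {n i b X} d → SignedSet n i b X → coeffR X i d ≡ coeffR₀ X i d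
coeffR≡coeffR₀ {n} {i} {X = X} d X-signed = count-cong-∈ _ (perms X) λ {π} π∈ →
  cong (λ σ → endsWith _==_ (+ i) π ∧ (desB₀ σ ≡ᵇ d))
    (red-id {n} π (↭-trans (map⁺ ∣_∣ (∈-perms⇒↭ X π∈)) (SignedSet.abs↭oneTo X-signed)))

hypotheses⇒SignedSet : ∀ {n i X} → i ≤ n → Unique X → length X ≡ n →
  (∀ x → x ∈ X → (+ 1 ℤ.≤ x × x ℤ.≤ + i) ⊎ (suc i ≤ ∣ x ∣ × ∣ x ∣ ≤ n)) →
  (∀ r → suc i ≤ r → r ≤ n → (+ r ∈ X × - (+ r) ∉ X) ⊎ (+ r ∉ X × - (+ r) ∈ X)) →
  SignedSet n i n X
hypotheses⇒SignedSet {n} {i} {X} i≤n X-unique length≡n entries signs = record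
  { length≡n = length≡n ; unique = X-unique ; no-opposite = no-opposite
  ; abs-bounds = abs-bounds ; neg-bounds = neg-bounds }
  where
  negative : ∀ {k} → -[1+ k ] ∈ X → i ≤ k × k < n
  negative -k∈X with entries _ -k∈X
  ... | inj₂ (s≤s i≤k , k<n) = i≤k , k<n
  neg-bounds : ∀ {k} → -[1+ k ] ∈ X → i ≤ k × k < i + n
  neg-bounds -k∈X with i≤k , k<n ← negative -k∈X = i≤k , ℕₚ.≤-trans k<n (ℕₚ.m≤n+m n i)
  no-opposite : ∀ {k} → + suc k ∈ X → -[1+ k ] ∉ X
  no-opposite {k} +k∈X -k∈X with i≤k , k<n ← negative -k∈X with signs (suc k) (s≤s i≤k) k<n
  ... | inj₁ (_ , -k∉X) = -k∉X -k∈X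
  ... | inj₂ (+k∉X , _) = +k∉X +k∈X
  abs-bounds : ∀ {x} → x ∈ X → 1 ≤ ∣ x ∣ × ∣ x ∣ ≤ n
  abs-bounds x∈X with entries _ x∈X
  abs-bounds {+ _} x∈X | inj₁ (+≤+ 1≤k , +≤+ k≤i) = 1≤k , ℕₚ.≤-trans k≤i i≤n
  ... | inj₂ (i<∣x∣ , ∣x∣≤n) = ℕₚ.≤-trans (s≤s z≤n) i<∣x∣ , ∣x∣≤n

lemma2p1 : (n i : ℕ) → 1 ≤ i → i ≤ n →
    (X : List ℤ) → Unique X → length X ≡ n →
    (∀ x → x ∈ X → (+ 1 ℤ.≤ x × x ℤ.≤ + i) ⊎ (suc i ≤ ∣ x ∣ × ∣ x ∣ ≤ n)) →
    (∀ k → 1 ≤ k → k ≤ i → + k ∈ X) →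
    (∀ r → suc i ≤ r → r ≤ n → (+ r ∈ X × - (+ r) ∉ X) ⊎ (+ r ∉ X × - (+ r) ∈ X)) →
    ∀ d → coeffR X i d ≡ coeffA n i d
lemma2p1 n i _ i≤n X X-unique length≡n entries _ signs d =
  trans (coeffR≡coeffR₀ d X-signed) (coeffR₀≡coeffA n d X-signed)
  where
  X-signed : SignedSet n i n X
  X-signed = hypotheses⇒SignedSet i≤n X-unique length≡n entries signs
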